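{- Let $G$ be a graph, $u\in V(G)$, and $T$ a tree that is not a star. Let $GT$ be the graph obtained by identifying a vertex of $T$ with the vertex $u$ of $G$, and let $GS$ be the graph obtained from $G$ by attaching $|E(T)|$ pendent edges at $u$ (i.e., adding $|E(T)|$ new vertices each adjacent only to $u$). Then $\Pi_1(GT)>\Pi_1(GS)$ and $\Pi_2(GT)<\Pi_2(GS)$.
   Context: For a graph $G$ with vertex degrees $d(u)$: $\Pi_1(G)=\prod_{u\in V(G)} d(u)^2$ and $\Pi_2(G)=\prod_{uv\in E(G)} d(u)d(v)=\prod_{u\in V(G)} d(u)^{d(u)}$. -}

module Defs where

open import Data.Nat using (ℕ; zero; suc; _+_; _*_; _^_; _≤_)
open import Data.Fin using (Fin; splitAt; punchIn; _≟_; _<?_)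
open import Data.Bool using (Bool; true; false; if_then_else_; _∧_)
open import Data.Sum using (_⊎_; inj₁; inj₂)
open import Data.Product using (Σ; ∃; _×_; _,_)
open import Data.List using (List; []; _∷_; map; length; _∷ʳ_; allFin)
open import Data.Nat.ListAction using (sum; product)
open import Data.List.Relation.Unary.Linked using (Linked)
open import Data.List.Relation.Unary.Unique.Propositional using (Unique)
open import Relation.Nullary using (¬_)
open import Relation.Nullary.Decidable using (⌊_⌋)
open import Relation.Binary.PropositionalEquality using (_≡_; _≢_; refl)

record Graph (n : ℕ) : Set where
  field
    adj    : Fin n → Fin n → Bool
    sym    : ∀ a b → adj a b ≡ adj b a
    irrefl : ∀ a → adj a a ≡ false
open Graph public

Adj : ∀ {n} → Graph n → Fin n → Fin n → Set
Adj G a b = adj G a b ≡ true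

deg : ∀ {n} → Graph n → Fin n → ℕ
deg {n} G v = sum (map (λ w → if adj G v w then 1 else 0) (allFin n))

edgeCount : ∀ {n} → Graph n → ℕ
edgeCount {n} G =
  sum (map (λ a → sum (map (λ b → if adj G a b ∧ ⌊ a <? b ⌋ then 1 else 0) (allFin n))) (allFin n))

-- Π₁(G) = ∏_v d(v)^2 ,  Π₂(G) = ∏_v d(v)^{d(v)}  (= ∏_{uv ∈ E} d(u) d(v))
Π₁ : ∀ {n} → Graph n → ℕ
Π₁ {n} G = product (map (λ v → deg G v ^ 2) (allFin n))

Π₂ : ∀ {n} → Graph n → ℕ
Π₂ {n} G = product (map (λ v → deg G v ^ deg G v) (allFin n))

data Reach {n} (G : Graph n) : Fin n → Fin n → Set where
  here : ∀ {a} → Reach G a a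
  step : ∀ {a b c} → Adj G a b → Reach G b c → Reach G a c

Connected : ∀ {n} → Graph n → Set
Connected G = ∀ a b → Reach G a b

HasCycle : ∀ {n} → Graph n → Set
HasCycle {n} G = Σ (Fin n) λ v → Σ (List (Fin n)) λ vs →
  (2 ≤ length vs) × Unique (v ∷ vs) × Linked (Adj G) ((v ∷ vs) ∷ʳ v)

IsTree : ∀ {n} → Graph n → Set
IsTree G = Connected G × ¬ HasCycle G

IsStar : ∀ {n} → Graph n → Set
IsStar {n} G = Σ (Fin n) λ c →
  (∀ x → x ≢ c → Adj G c x) × (∀ x y → Adj G x y → (x ≡ c ⊎ y ≡ c))

-- GT: vertices Fin n ⊎ (V(T) minus w); w ∈ V(T) is identified with u ∈ V(G).
-- vertex inj₂ i stands for the vertex punchIn w i of T.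
module _ {n m : ℕ} (G : Graph n) (u : Fin n) (T : Graph (suc m)) (w : Fin (suc m)) where
  private
    aS : Fin n ⊎ Fin m → Fin n ⊎ Fin m → Bool
    aS (inj₁ a) (inj₁ b) = adj G a b
    aS (inj₁ a) (inj₂ j) = ⌊ a ≟ u ⌋ ∧ adj T w (punchIn w j)
    aS (inj₂ i) (inj₁ b) = ⌊ b ≟ u ⌋ ∧ adj T w (punchIn w i)
    aS (inj₂ i) (inj₂ j) = adj T (punchIn w i) (punchIn w j)

    sS : ∀ x y → aS x y ≡ aS y x
    sS (inj₁ a) (inj₁ b) = sym G a b
    sS (inj₁ a) (inj₂ j) = refl
    sS (inj₂ i) (inj₁ b) = refl
    sS (inj₂ i) (inj₂ j) = sym T (punchIn w i) (punchIn w j)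

    iS : ∀ x → aS x x ≡ false
    iS (inj₁ a) = irrefl G a
    iS (inj₂ i) = irrefl T (punchIn w i)

  glueTree : Graph (n + m)
  glueTree = record
    { adj    = λ x y → aS (splitAt n x) (splitAt n y)
    ; sym    = λ x y → sS (splitAt n x) (splitAt n y)
    ; irrefl = λ x → iS (splitAt n x)
    }

module _ {n : ℕ} (G : Graph n) (u : Fin n) (k : ℕ) where
  private
    aP : Fin n ⊎ Fin k → Fin n ⊎ Fin k → Bool
    aP (inj₁ a) (inj₁ b) = adj G a b
    aP (inj₁ a) (inj₂ j) = ⌊ a ≟ u ⌋
    aP (inj₂ i) (inj₁ b) = ⌊ b ≟ u ⌋
    aP (inj₂ i) (inj₂ j) = false

    sP : ∀ x y → aP x y ≡ aP y x
    sP (inj₁ a) (inj₁ b) = sym G a b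
    sP (inj₁ a) (inj₂ j) = refl
    sP (inj₂ i) (inj₁ b) = refl
    sP (inj₂ i) (inj₂ j) = refl

    iP : ∀ x → aP x x ≡ false
    iP (inj₁ a) = irrefl G a
    iP (inj₂ i) = refl

  attachPendents : Graph (n + k)
  attachPendents = record
    { adj    = λ x y → aP (splitAt n x) (splitAt n y)
    ; sym    = λ x y → sP (splitAt n x) (splitAt n y)
    ; irrefl = λ x → iP (splitAt n x)
    }

-- The vertices of G other than u keep their degrees in GT and in GS, so they
-- contribute the same positive factor to both sides.  In GT the vertices of T carry
-- the degrees `merged` (deg G u + deg T w at w, deg T v elsewhere); write them as
-- 1 + e v (e = excess).  In GS the vertex u has degree deg G u + |E(T)| = 1 + Σ e
-- (the degrees of a tree sum to 2|E(T)| = 2m), and the pendants have degree 1.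
-- So GS is obtained from GT by merging the T-side degrees into one vertex, and the
-- theorem reduces to the two merging inequalities
--     1 + Σ e < ∏ (1 + e)    and    ∏ (1 + e)^(1 + e) < (1 + Σ e)^(1 + Σ e),
-- which are strict as soon as two of the e v are ≥ 1, i.e. T has two vertices of
-- degree ≥ 2 — exactly what "not a star" gives.  The second inequality comes from
-- Bernoulli's inequality.
module Submission where

open import Defs hiding (sym)
open import Defs using () renaming (sym to adj-comm)
open import Algebra.Bundles using (Monoid)
open import Data.Bool using (Bool; true; false; if_then_else_; _∧_)
open import Data.Bool.Properties using (∧-identityʳ) renaming (_≟_ to _≟ᵇ_)
open import Data.Nat using (ℕ; zero; suc; pred; _+_; _*_; _^_; _≤_; _<_; z≤n; s≤s; _≤?_; NonZero; >-nonZero)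
open import Data.Nat.Properties
  using (≤-refl; ≤-reflexive; ≤-trans; ≤-pred; ≰⇒>; <⇒≱; m≤m+n; m≤n+m; m<m+n;
         +-comm; +-assoc; *-assoc; +-suc; +-identityʳ; +-cancelʳ-≡; *-identityʳ; suc-injective; suc-pred;
         +-monoʳ-≤; *-mono-≤; *-monoʳ-≤; *-monoˡ-≤; *-monoʳ-<; *-monoˡ-<;
         ^-monoˡ-≤; ^-monoˡ-<; ^-distribˡ-+-*; m^n≢0; m^n>0; module ≤-Reasoning;
         +-0-monoid; *-1-monoid; +-0-commutativeMonoid; *-1-commutativeMonoid; *-commutativeSemigroup)
open import Data.Nat.Tactic.RingSolver using (solve-∀)
open import Data.Nat.ListAction using (product)
open import Algebra.Properties.CommutativeSemigroup *-commutativeSemigroup using (xy∙z≈xz∙y)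
open import Algebra.Properties.CommutativeMonoid.Sum +-0-commutativeMonoid
  using (sum; sum-remove; sum-cong-≗; sum-replicate-zero; ∑-distrib-+; ∑-comm)
open import Algebra.Properties.CommutativeMonoid.Sum *-1-commutativeMonoid
  using () renaming (sum to prod; sum-remove to prod-remove; sum-cong-≗ to prod-cong-≗;
                     sum-replicate-zero to prod-ones; ∑-distrib-+ to ∏-distrib-*)
open import Data.Fin using (Fin; punchIn; punchOut; _↑ˡ_; _↑ʳ_; _<?_)
  renaming (zero to fzero; suc to fsuc; _<_ to _<ᶠ_)
open import Data.Fin.Properties
  using (punchIn-punchOut; punchInᵢ≢i; punchIn-injective; splitAt-↑ˡ; splitAt-↑ʳ;
         <-cmp; <-asym; <⇒≢; pigeonhole; any?; all?; ¬∀⟶∃¬)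
  renaming (_≟_ to _≟ᶠ_)
open import Data.Product using (∃; _×_; _,_; proj₁; proj₂)
open import Data.Sum using (_⊎_; inj₁; inj₂)
open import Data.Vec.Functional using (removeAt; insertAt)
import Data.Vec.Functional as Vector
open import Data.Vec.Functional.Properties using (insertAt-lookup; insertAt-punchIn; removeAt-insertAt)
open import Data.List using (List; []; _∷_; _++_; [_]; _∷ʳ_; length; lookup; map)
import Data.List as List
import Data.List.Properties as List
open import Data.List.Relation.Unary.All using ([]; _∷_)
import Data.List.Relation.Unary.All as All
import Data.List.Relation.Unary.All.Properties as All
open import Data.List.Relation.Unary.AllPairs using ([]; _∷_)
open import Data.List.Relation.Unary.Linked using (Linked; []; [-]; _∷_)
import Data.List.Relation.Unary.Linked.Properties as Linked
open import Data.List.Relation.Unary.Unique.Propositional using (Unique)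
import Data.List.Relation.Unary.Unique.Propositional.Properties as Unique
open import Data.List.Membership.Propositional.Properties using (∈-lookup; ∈-∃++)
import Data.List.Membership.DecPropositional as DecMembership
open import Function using (_∘_)
open import Relation.Nullary using (¬_; Dec; yes; no; contradiction; ¬?)
open import Relation.Nullary.Decidable using (⌊_⌋; _×-dec_; _→-dec_; dec-true; dec-false; isYes≗does)
open import Relation.Binary.Definitions using (tri<; tri≈; tri>)
open import Relation.Binary.PropositionalEquality hiding ([_])

module SplitSum {c ℓ} (M : Monoid c ℓ) where
  open Monoid M using (Carrier; _≈_; _∙_; ∙-congˡ; identityˡ; assoc)
    renaming (sym to ≈-sym; trans to ≈-trans)
  open import Algebra.Properties.Monoid.Sum M using () renaming (sum to ∑)

  ∑-↑ : ∀ {n m} (f : Fin (n + m) → Carrier) →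
        ∑ f ≈ ∑ (λ a → f (a ↑ˡ m)) ∙ ∑ (λ j → f (n ↑ʳ j))
  ∑-↑ {zero}  f = ≈-sym (identityˡ _)
  ∑-↑ {suc n} {m} f = ≈-trans (∙-congˡ (∑-↑ {n} {m} (f ∘ fsuc))) (≈-sym (assoc _ _ _))

open SplitSum +-0-monoid public using () renaming (∑-↑ to sum-↑)
open SplitSum *-1-monoid public using () renaming (∑-↑ to prod-↑)

term≤sum : ∀ {k} (t : Fin k → ℕ) i → t i ≤ sum t
term≤sum {suc k} t i = subst (t i ≤_) (sym (sum-remove t)) (m≤m+n (t i) _)

term≤sum-removeAt : ∀ {k} (t : Fin (suc k) → ℕ) {i j} (i≢j : i ≢ j) → t j ≤ sum (removeAt t i)
term≤sum-removeAt t {i} i≢j =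
  subst (_≤ sum (removeAt t i)) (cong t (punchIn-punchOut i≢j)) (term≤sum (removeAt t i) (punchOut i≢j))

sum-zero : ∀ {k} (t : Fin k → ℕ) → (∀ i → t i ≡ 0) → sum t ≡ 0
sum-zero {k} t t≗0 = trans (sum-cong-≗ {k} t≗0) (sum-replicate-zero k)

sum-ones : ∀ k → sum {k} (λ _ → 1) ≡ k
sum-ones zero    = refl
sum-ones (suc k) = cong suc (sum-ones k)

sum-suc : ∀ {k} (e : Fin k → ℕ) → sum (suc ∘ e) ≡ sum e + k
sum-suc {k} e = trans (∑-distrib-+ (λ _ → 1) e) (trans (cong (_+ sum e) (sum-ones k)) (+-comm k (sum e)))

prod-insertAt : ∀ {k} (g : ℕ → ℕ) (t : Fin k → ℕ) i x →
                prod (g ∘ insertAt t i x) ≡ g x * prod (g ∘ t)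
prod-insertAt g t i x = trans (prod-remove {i = i} (g ∘ insertAt t i x))
  (cong₂ _*_ (cong g (insertAt-lookup t i x)) (prod-cong-≗ (cong g ∘ removeAt-insertAt t i x)))

sum-insertAt : ∀ {k} (t : Fin k → ℕ) i x → sum (insertAt t i x) ≡ x + sum t
sum-insertAt t i x = trans (sum-remove {i = i} (insertAt t i x))
  (cong₂ _+_ (insertAt-lookup t i x) (sum-cong-≗ (removeAt-insertAt t i x)))

prod-positive : ∀ {k} (t : Fin k → ℕ) → (∀ i → 1 ≤ t i) → 1 ≤ prod t
prod-positive {zero}  t _   = ≤-refl
prod-positive {suc k} t pos = *-mono-≤ (pos fzero) (prod-positive (t ∘ fsuc) (pos ∘ fsuc))

prod-square : ∀ {k} (t : Fin k → ℕ) → prod (λ i → t i ^ 2) ≡ prod t ^ 2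
prod-square t = trans (∏-distrib-* t (λ i → t i * 1))
  (cong (prod t *_) (trans (prod-cong-≗ (λ i → *-identityʳ (t i))) (sym (*-identityʳ (prod t)))))

-- Merging inequalities

-- Identifying two vertices of degrees 1 + a and 1 + b (whose neighbourhoods share
-- one vertex) gives degree 1 + a + b, which is at most the product of the two
-- degrees, strictly if a, b ≥ 1.
merge-≤-* : ∀ a b → suc (a + b) ≤ suc a * suc b
merge-≤-* a b = subst (suc (a + b) ≤_) (sym (expand a b)) (s≤s (m≤m+n (a + b) (a * b)))
  where
  expand : ∀ a b → suc a * suc b ≡ suc (a + b + a * b)
  expand = solve-∀

merge-<-* : ∀ a b → 1 ≤ a → 1 ≤ b → suc (a + b) < suc a * suc b
merge-<-* (suc a) (suc b) _ _ =
  subst (suc (suc a + suc b) <_) (sym (expand a b)) (m<m+n _ (s≤s z≤n))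
  where
  expand : ∀ a b → suc (suc a) * suc (suc b) ≡ suc (suc a + suc b) + suc (a + b + a * b)
  expand = solve-∀

pw : ℕ → ℕ
pw x = x ^ x

pw-positive : ∀ x → 1 ≤ pw x
pw-positive zero    = s≤s z≤n
pw-positive (suc x) = m^n>0 (suc x) (suc x)

bernoulli : ∀ x e n → x ^ suc n + suc n * e * x ^ n ≤ (x + e) ^ suc n
bernoulli x e zero = ≤-reflexive (base x e)
  where
  base : ∀ x e → x * 1 + 1 * e * 1 ≡ (x + e) * 1
  base = solve-∀
bernoulli x e (suc n) = begin
    x ^ suc (suc n) + suc (suc n) * e * x ^ suc n
  ≤⟨ m≤m+n _ (suc n * e * e * x ^ n) ⟩
    x ^ suc (suc n) + suc (suc n) * e * x ^ suc n + suc n * e * e * x ^ n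
  ≡⟨ expand x e n (x ^ n) ⟩
    (x + e) * (x ^ suc n + suc n * e * x ^ n)
  ≤⟨ *-monoʳ-≤ (x + e) (bernoulli x e n) ⟩
    (x + e) ^ suc (suc n)
  ∎
  where
  open ≤-Reasoning
  expand : ∀ x e n q → x * (x * q) + suc (suc n) * e * (x * q) + suc n * e * e * q
                       ≡ (x + e) * (x * q + suc n * e * q)
  expand = solve-∀

pw-bernoulli : ∀ a b → pw (suc a) * suc b ≤ (suc a + b) ^ suc a
pw-bernoulli a b = subst (_≤ (suc a + b) ^ suc a) (regroup a b (suc a ^ a)) (bernoulli (suc a) b a)
  where
  regroup : ∀ a b p → suc a * p + suc a * b * p ≡ suc a * p * suc b
  regroup = solve-∀

pw-merge-bound : ∀ a b → pw (suc a) * pw (suc b) ≤ (suc a + b) ^ suc a * suc b ^ b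
pw-merge-bound a b = begin
    pw (suc a) * (suc b * suc b ^ b)
  ≡⟨ sym (*-assoc (pw (suc a)) (suc b) _) ⟩
    pw (suc a) * suc b * suc b ^ b
  ≤⟨ *-monoˡ-≤ (suc b ^ b) (pw-bernoulli a b) ⟩
    (suc a + b) ^ suc a * suc b ^ b
  ∎ where open ≤-Reasoning

merge-pw-≤ : ∀ a b → pw (suc a) * pw (suc b) ≤ pw (suc (a + b))
merge-pw-≤ a b = begin
    pw (suc a) * pw (suc b)
  ≤⟨ pw-merge-bound a b ⟩
    (suc a + b) ^ suc a * suc b ^ b
  ≤⟨ *-monoʳ-≤ ((suc a + b) ^ suc a) (^-monoˡ-≤ b (s≤s (m≤n+m b a))) ⟩
    (suc a + b) ^ suc a * (suc a + b) ^ b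
  ≡⟨ sym (^-distribˡ-+-* (suc a + b) (suc a) b) ⟩
    pw (suc (a + b))
  ∎ where open ≤-Reasoning

merge-pw-< : ∀ a b → 1 ≤ a → 1 ≤ b → pw (suc a) * pw (suc b) < pw (suc (a + b))
merge-pw-< (suc a) (suc b) _ _ = begin-strict
    pw (suc (suc a)) * pw (suc (suc b))
  ≤⟨ pw-merge-bound (suc a) (suc b) ⟩
    c ^ suc (suc a) * suc (suc b) ^ suc b
  <⟨ *-monoʳ-< (c ^ suc (suc a)) {{m^n≢0 c (suc (suc a))}} (^-monoˡ-< (suc b) 2+b<c) ⟩
    c ^ suc (suc a) * c ^ suc b
  ≡⟨ sym (^-distribˡ-+-* c (suc (suc a)) (suc b)) ⟩
    pw (suc (suc a + suc b))
  ∎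
  where
  open ≤-Reasoning
  c : ℕ
  c = suc (suc a) + suc b
  2+b<c : suc (suc b) < c
  2+b<c = s≤s (s≤s (m≤n+m (suc b) a))

merge-all-≤-prod : ∀ {k} (a : Fin k → ℕ) → suc (sum a) ≤ prod (suc ∘ a)
merge-all-≤-prod {zero}  a = ≤-refl
merge-all-≤-prod {suc k} a = begin
    suc (a fzero + sum (a ∘ fsuc))
  ≤⟨ merge-≤-* (a fzero) (sum (a ∘ fsuc)) ⟩
    suc (a fzero) * suc (sum (a ∘ fsuc))
  ≤⟨ *-monoʳ-≤ (suc (a fzero)) (merge-all-≤-prod (a ∘ fsuc)) ⟩
    suc (a fzero) * prod (suc ∘ a ∘ fsuc)
  ∎ where open ≤-Reasoning

merge-all-<-prod : ∀ {k} (a : Fin k → ℕ) {i j} → i ≢ j → 1 ≤ a i → 1 ≤ a j →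
                   suc (sum a) < prod (suc ∘ a)
merge-all-<-prod {suc k} a {i} i≢j 1≤aᵢ 1≤aⱼ = begin-strict
    suc (sum a)
  ≡⟨ cong suc (sum-remove {i = i} a) ⟩
    suc (a i + rest)
  <⟨ merge-<-* (a i) rest 1≤aᵢ (≤-trans 1≤aⱼ (term≤sum-removeAt a i≢j)) ⟩
    suc (a i) * suc rest
  ≤⟨ *-monoʳ-≤ (suc (a i)) (merge-all-≤-prod (removeAt a i)) ⟩
    suc (a i) * prod (suc ∘ removeAt a i)
  ≡⟨ sym (prod-remove {i = i} (suc ∘ a)) ⟩
    prod (suc ∘ a)
  ∎
  where
  open ≤-Reasoning
  rest : ℕ
  rest = sum (removeAt a i)

merge-all-pw-≤ : ∀ {k} (a : Fin k → ℕ) → prod (pw ∘ suc ∘ a) ≤ pw (suc (sum a))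
merge-all-pw-≤ {zero}  a = ≤-refl
merge-all-pw-≤ {suc k} a = begin
    pw (suc (a fzero)) * prod (pw ∘ suc ∘ a ∘ fsuc)
  ≤⟨ *-monoʳ-≤ (pw (suc (a fzero))) (merge-all-pw-≤ (a ∘ fsuc)) ⟩
    pw (suc (a fzero)) * pw (suc (sum (a ∘ fsuc)))
  ≤⟨ merge-pw-≤ (a fzero) (sum (a ∘ fsuc)) ⟩
    pw (suc (a fzero + sum (a ∘ fsuc)))
  ∎ where open ≤-Reasoning

merge-all-pw-< : ∀ {k} (a : Fin k → ℕ) {i j} → i ≢ j → 1 ≤ a i → 1 ≤ a j →
                 prod (pw ∘ suc ∘ a) < pw (suc (sum a))
merge-all-pw-< {suc k} a {i} i≢j 1≤aᵢ 1≤aⱼ = begin-strict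
    prod (pw ∘ suc ∘ a)
  ≡⟨ prod-remove {i = i} (pw ∘ suc ∘ a) ⟩
    pw (suc (a i)) * prod (pw ∘ suc ∘ removeAt a i)
  ≤⟨ *-monoʳ-≤ (pw (suc (a i))) (merge-all-pw-≤ (removeAt a i)) ⟩
    pw (suc (a i)) * pw (suc rest)
  <⟨ merge-pw-< (a i) rest 1≤aᵢ (≤-trans 1≤aⱼ (term≤sum-removeAt a i≢j)) ⟩
    pw (suc (a i + rest))
  ≡⟨ cong (pw ∘ suc) (sym (sum-remove {i = i} a)) ⟩
    pw (suc (sum a))
  ∎
  where
  open ≤-Reasoning
  rest : ℕ
  rest = sum (removeAt a i)

-- Degrees

foldr-allFin : ∀ {n} (_∙_ : ℕ → ℕ → ℕ) ε (f : Fin n → ℕ) →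
               List.foldr _∙_ ε (List.map f (List.allFin n)) ≡ Vector.foldr _∙_ ε f
foldr-allFin {n} _∙_ ε f = trans (cong (List.foldr _∙_ ε) (List.map-tabulate (λ i → i) f)) (foldr-tabulate f)
  where
  foldr-tabulate : ∀ {k} (g : Fin k → ℕ) → List.foldr _∙_ ε (List.tabulate g) ≡ Vector.foldr _∙_ ε g
  foldr-tabulate {zero}  g = refl
  foldr-tabulate {suc k} g = cong (g fzero ∙_) (foldr-tabulate (g ∘ fsuc))

ind : Bool → ℕ
ind b = if b then 1 else 0

deg-sum : ∀ {n} (G : Graph n) v → deg G v ≡ sum (λ x → ind (adj G v x))
deg-sum G v = foldr-allFin _+_ 0 (λ x → ind (adj G v x))

deg-remove : ∀ {n} (G : Graph (suc n)) v p →
             deg G v ≡ ind (adj G v p) + sum (λ i → ind (adj G v (punchIn p i)))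
deg-remove G v p = trans (deg-sum G v) (sum-remove {i = p} (λ x → ind (adj G v x)))

adj-symm : ∀ {n} (G : Graph n) {a b} → Adj G a b → Adj G b a
adj-symm G {a} {b} a~b = trans (adj-comm G b a) a~b

adj-≢ : ∀ {n} (G : Graph n) {a b} → Adj G a b → a ≢ b
adj-≢ G {a} a~a refl with trans (sym a~a) (irrefl G a)
... | ()

deg-≥1 : ∀ {n} (G : Graph (suc n)) {v x} → Adj G v x → 1 ≤ deg G v
deg-≥1 G {v} {x} v~x = begin
    1                                                         ≡⟨ cong ind v~x ⟨
    ind (adj G v x)                                           ≤⟨ m≤m+n _ _ ⟩
    ind (adj G v x) + sum (λ i → ind (adj G v (punchIn x i))) ≡⟨ deg-remove G v x ⟨
    deg G v                                                   ∎
  where open ≤-Reasoning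

deg-≥2 : ∀ {n} (G : Graph (suc n)) {v x y} → Adj G v x → Adj G v y → x ≢ y → 2 ≤ deg G v
deg-≥2 {n} G {v} {x} {y} v~x v~y x≢y = begin
    2                                                ≡⟨ cong₂ (λ b c → ind b + ind c) v~x v~y ⟨
    ind (adj G v x) + ind (adj G v y)                ≤⟨ +-monoʳ-≤ _ (term≤sum-removeAt nbr x≢y) ⟩
    ind (adj G v x) + sum (removeAt nbr x)           ≡⟨ deg-remove G v x ⟨
    deg G v                                          ∎
  where
  open ≤-Reasoning
  nbr : Fin (suc n) → ℕ
  nbr z = ind (adj G v z)

ind-false : ∀ {b} → ¬ (b ≡ true) → ind b ≡ 0
ind-false {false} _ = refl
ind-false {true}  b≢true = contradiction refl b≢true

deg-leaf : ∀ {n} (G : Graph (suc n)) {v p} → Adj G v p → (∀ x → Adj G v x → x ≡ p) → deg G v ≡ 1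
deg-leaf G {v} {p} v~p only-p = begin
    deg G v                                                   ≡⟨ deg-remove G v p ⟩
    ind (adj G v p) + sum (λ i → ind (adj G v (punchIn p i)))
      ≡⟨ cong₂ _+_ (cong ind v~p) (sum-zero _ no-other) ⟩
    1                                                         ∎
  where
  open ≡-Reasoning
  no-other : ∀ i → ind (adj G v (punchIn p i)) ≡ 0
  no-other i = ind-false (punchInᵢ≢i p i ∘ only-p (punchIn p i))

deg≤1-unique : ∀ {n} (G : Graph (suc n)) {v x y} → deg G v ≤ 1 → Adj G v x → Adj G v y → x ≡ y
deg≤1-unique G {x = x} {y} deg≤1 v~x v~y with x ≟ᶠ y
... | yes x≡y = x≡y
... | no  x≢y = contradiction (≤-trans (deg-≥2 G v~x v~y x≢y) deg≤1) (λ { (s≤s ()) })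

connected-deg-≥1 : ∀ {N} (H : Graph (suc N)) → Connected H → ∀ {v x} → v ≢ x → 1 ≤ deg H v
connected-deg-≥1 H H-conn {v} {x} v≢x with H-conn v x
... | here       = contradiction refl v≢x
... | step v~b _ = deg-≥1 H v~b

connected-positive : ∀ {N} (H : Graph (suc N)) → Connected H → ∀ {x y} → x ≢ y → ∀ v → 1 ≤ deg H v
connected-positive H H-conn {x} {y} x≢y v with v ≟ᶠ x
... | yes refl = connected-deg-≥1 H H-conn x≢y
... | no  v≢x  = connected-deg-≥1 H H-conn v≢x

one-orientation : ∀ {n} {a b : Fin n} → a ≢ b → ind ⌊ a <? b ⌋ + ind ⌊ b <? a ⌋ ≡ 1
one-orientation {a = a} {b} a≢b with a <? b | b <? a
... | yes a<b | yes b<a = contradiction b<a (<-asym a<b)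
... | yes _   | no _    = refl
... | no _    | yes _   = refl
... | no a≮b  | no b≮a  = contradiction (comparable a≮b b≮a) a≢b
  where
  comparable : ¬ a <ᶠ b → ¬ b <ᶠ a → a ≡ b
  comparable a≮b b≮a with <-cmp a b
  ... | tri< a<b _ _ = contradiction a<b a≮b
  ... | tri≈ _ a≡b _ = a≡b
  ... | tri> _ _ b<a = contradiction b<a b≮a

module Handshake {n} (G : Graph n) where
  edge< : Fin n → Fin n → ℕ
  edge< a b = ind (adj G a b ∧ ⌊ a <? b ⌋)

  edgeCount-sum : edgeCount G ≡ sum (λ a → sum (edge< a))
  edgeCount-sum = trans (foldr-allFin _+_ 0 (λ a → List.foldr _+_ 0 (List.map (edge< a) (List.allFin n))))
                        (sum-cong-≗ (λ a → foldr-allFin _+_ 0 (edge< a)))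

  -- every edge is listed in exactly one orientation
  edge-split : ∀ a b → ind (adj G a b) ≡ edge< a b + edge< b a
  edge-split a b rewrite adj-comm G b a with adj G a b in a~b
  ... | false = refl
  ... | true  = sym (one-orientation (adj-≢ G a~b))

  handshake : sum (deg G) ≡ edgeCount G + edgeCount G
  handshake = begin
      sum (deg G)
    ≡⟨ sum-cong-≗ (λ a → trans (deg-sum G a) (sum-cong-≗ (edge-split a))) ⟩
      sum (λ a → sum (λ b → edge< a b + edge< b a))
    ≡⟨ sum-cong-≗ (λ a → ∑-distrib-+ (edge< a) (λ b → edge< b a)) ⟩
      sum (λ a → sum (edge< a) + sum (λ b → edge< b a))
    ≡⟨ ∑-distrib-+ (λ a → sum (edge< a)) (λ a → sum (λ b → edge< b a)) ⟩
      sum (λ a → sum (edge< a)) + sum (λ a → sum (λ b → edge< b a))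
    ≡⟨ cong (sum (λ a → sum (edge< a)) +_) (∑-comm (λ a b → edge< b a)) ⟩
      sum (λ a → sum (edge< a)) + sum (λ b → sum (edge< b))
    ≡⟨ cong₂ _+_ edgeCount-sum edgeCount-sum ⟨
      edgeCount G + edgeCount G
    ∎ where open ≡-Reasoning

unique-lookup : ∀ {A : Set} {xs : List A} → Unique xs → ∀ {i j} → i ≢ j → lookup xs i ≢ lookup xs j
unique-lookup (x∉xs ∷ _) {fzero}  {fzero}  i≢j = contradiction refl i≢j
unique-lookup (x∉xs ∷ _) {fzero}  {fsuc j} _   = All.lookup x∉xs (∈-lookup j)
unique-lookup (x∉xs ∷ _) {fsuc i} {fzero}  _   = ≢-sym (All.lookup x∉xs (∈-lookup i))
unique-lookup (_ ∷ xs!)  {fsuc i} {fsuc j} i≢j = unique-lookup xs! (i≢j ∘ cong fsuc)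

unique-length : ∀ {N} (xs : List (Fin N)) → Unique xs → length xs ≤ N
unique-length {N} xs xs! with length xs ≤? N
... | yes fits = fits
... | no too-long with pigeonhole (≰⇒> too-long) (lookup xs)
...   | i , j , i<j , same = contradiction same (unique-lookup xs! (<⇒≢ i<j))

unique-prefix : ∀ {A : Set} (xs ys : List A) → Unique (xs ++ ys) → Unique xs
unique-prefix []       ys _           = []
unique-prefix (x ∷ xs) ys (x∉ ∷ xs!) = All.++⁻ˡ xs x∉ ∷ unique-prefix xs ys xs!

linked-cut : ∀ {A : Set} {R : A → A → Set} (xs : List A) {y z zs} →
             Linked R (xs ++ y ∷ zs) → R y z → Linked R (xs ++ y ∷ z ∷ [])
linked-cut []           _          Ryz = Ryz ∷ [-]
linked-cut (_ ∷ [])     (R₁ ∷ Rs)  Ryz = R₁ ∷ linked-cut [] Rs Ryz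
linked-cut (_ ∷ x ∷ xs) (R₁ ∷ Rs)  Ryz = R₁ ∷ linked-cut (x ∷ xs) Rs Ryz

-- Removing a leaf from a tree

IsLeaf : ∀ {n} → Graph n → Fin n → Fin n → Set
IsLeaf T ℓ p = Adj T ℓ p × (∀ x → Adj T ℓ x → x ≡ p)

removeVertex : ∀ {m} → Graph (suc m) → Fin (suc m) → Graph m
removeVertex T ℓ = record
  { adj    = λ i j → adj T (punchIn ℓ i) (punchIn ℓ j)
  ; sym    = λ i j → adj-comm T (punchIn ℓ i) (punchIn ℓ j)
  ; irrefl = λ i → irrefl T (punchIn ℓ i)
  }

module LeafRemoval {m} (T : Graph (suc m)) {ℓ p} (leaf : IsLeaf T ℓ p) where
  T′ : Graph m
  T′ = removeVertex T ℓ

  -- A walk between two vertices other than ℓ never needs to pass through ℓ: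
  -- entering ℓ forces leaving it towards p, where the walk came from.
  avoid-leaf : ∀ {s t} → Reach T s t → ∀ i j → s ≡ punchIn ℓ i → t ≡ punchIn ℓ j → Reach T′ i j
  avoid-leaf here i j refl t≡ = subst (Reach T′ i) (punchIn-injective ℓ i j t≡) here
  avoid-leaf (step {b = b} s~b b⇝t) i j refl t≡ with ℓ ≟ᶠ b
  ... | no ℓ≢b = step (subst (Adj T (punchIn ℓ i)) (sym (punchIn-punchOut ℓ≢b)) s~b)
                      (avoid-leaf b⇝t (punchOut ℓ≢b) j (sym (punchIn-punchOut ℓ≢b)) t≡)
  ... | yes refl = leave b⇝t t≡
    where
    leave : ∀ {t} → Reach T ℓ t → t ≡ punchIn ℓ j → Reach T′ i j
    leave here t≡ = contradiction (sym t≡) (punchInᵢ≢i ℓ j)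
    leave (step ℓ~c c⇝t) t≡ =
      avoid-leaf c⇝t i j (trans (proj₂ leaf _ ℓ~c) (sym (proj₂ leaf _ (adj-symm T s~b)))) t≡

  connected : Connected T → Connected T′
  connected T-conn i j = avoid-leaf (T-conn (punchIn ℓ i) (punchIn ℓ j)) i j refl refl

  -- A cycle of T′ is a cycle of T.
  acyclic : ¬ HasCycle T → ¬ HasCycle T′
  acyclic no-cycle (v , vs , long , distinct , linked) =
    no-cycle (punchIn ℓ v , map (punchIn ℓ) vs
             , subst (2 ≤_) (sym (List.length-map (punchIn ℓ) vs)) long
             , Unique.map⁺ (punchIn-injective ℓ _ _) distinct
             , subst (Linked (Adj T)) (List.map-++ (punchIn ℓ) (v ∷ vs) [ v ]) (Linked.map⁺ linked))

  is-tree : IsTree T → IsTree T′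
  is-tree (T-conn , no-cycle) = connected T-conn , acyclic no-cycle

  -- Removing the leaf lowers the degree sum by 2: one for ℓ, one for p.
  degree-sum : sum (deg T) ≡ 2 + sum (deg T′)
  degree-sum = begin
      sum (deg T)
    ≡⟨ sum-remove {i = ℓ} (deg T) ⟩
      deg T ℓ + sum (λ i → deg T (punchIn ℓ i))
    ≡⟨ cong₂ _+_ (deg-leaf T (proj₁ leaf) (proj₂ leaf)) (sum-cong-≗ deg-punchIn) ⟩
      1 + sum (λ i → ind (adj T ℓ (punchIn ℓ i)) + deg T′ i)
    ≡⟨ cong (1 +_) (∑-distrib-+ (λ i → ind (adj T ℓ (punchIn ℓ i))) (deg T′)) ⟩
      1 + (sum (λ i → ind (adj T ℓ (punchIn ℓ i))) + sum (deg T′))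
    ≡⟨ cong (λ k → 1 + (k + sum (deg T′))) leaf-edges ⟩
      2 + sum (deg T′)
    ∎
    where
    open ≡-Reasoning
    deg-punchIn : ∀ i → deg T (punchIn ℓ i) ≡ ind (adj T ℓ (punchIn ℓ i)) + deg T′ i
    deg-punchIn i = trans (deg-remove T (punchIn ℓ i) ℓ)
      (cong₂ _+_ (cong ind (adj-comm T (punchIn ℓ i) ℓ)) (sym (deg-sum T′ i)))
    others : ℕ
    others = sum (λ i → ind (adj T ℓ (punchIn ℓ i)))
    leaf-edges : others ≡ 1
    leaf-edges = begin
      others                    ≡⟨ cong (λ b → ind b + others) (irrefl T ℓ) ⟨
      ind (adj T ℓ ℓ) + others  ≡⟨ deg-remove T ℓ ℓ ⟨
      deg T ℓ                   ≡⟨ deg-leaf T (proj₁ leaf) (proj₂ leaf) ⟩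
      1                         ∎

-- If every vertex has, besides any given neighbour, a further neighbour, then a
-- non-backtracking walk can be extended forever; in a finite graph it must
-- revisit a vertex, and the part of the walk between the two visits is a cycle.
module BranchingWalk {N} (G : Graph N)
  (branch : ∀ v p → Adj G v p → ∃ λ x → Adj G v x × x ≢ p) where

  -- The walk is stored newest vertex first: cur, prev, ....  If cur is adjacent
  -- to an earlier vertex x, the vertices from cur back to x form a cycle.
  close : ∀ cur prev x ys zs → Unique (cur ∷ prev ∷ ys ++ x ∷ zs) →
          Linked (Adj G) (cur ∷ prev ∷ ys ++ x ∷ zs) → Adj G cur x → HasCycle G
  close cur prev x ys zs distinct linked cur~x =
    cur , prev ∷ ys ++ [ x ] , long , distinct′ , linked′
    where
    long : 2 ≤ length (prev ∷ ys ++ [ x ])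
    long = s≤s (subst (1 ≤_) (sym (List.length-++ ys)) (m≤n+m 1 (length ys)))
    distinct′ : Unique (cur ∷ prev ∷ ys ++ [ x ])
    distinct′ = unique-prefix (cur ∷ prev ∷ ys ++ [ x ]) zs
      (subst Unique (cong (λ l → cur ∷ prev ∷ l) (sym (List.++-assoc ys [ x ] zs))) distinct)
    linked′ : Linked (Adj G) ((cur ∷ prev ∷ ys ++ [ x ]) ∷ʳ cur)
    linked′ = subst (Linked (Adj G)) (cong (λ l → cur ∷ prev ∷ l) (sym (List.++-assoc ys [ x ] [ cur ])))
      (linked-cut (cur ∷ prev ∷ ys) linked (adj-symm G cur~x))

  -- The fuel bounds how often the walk can still grow before it would exceed N vertices.
  walk : (fuel : ℕ) (cur prev : Fin N) (rest : List (Fin N)) →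
         Unique (cur ∷ prev ∷ rest) → Linked (Adj G) (cur ∷ prev ∷ rest) →
         N < fuel + length (cur ∷ prev ∷ rest) → HasCycle G
  walk zero cur prev rest distinct _ too-long =
    contradiction (unique-length _ distinct) (<⇒≱ too-long)
  walk (suc fuel) cur prev rest distinct (cur~prev ∷ linked) bound
    with branch cur prev cur~prev
  ... | x , cur~x , x≢prev with DecMembership._∈?_ _≟ᶠ_ x (cur ∷ prev ∷ rest)
  ...   | no x∉walk = walk fuel x cur (prev ∷ rest) (All.¬Any⇒All¬ _ x∉walk ∷ distinct)
                        (adj-symm G cur~x ∷ cur~prev ∷ linked) (subst (N <_) (sym (+-suc fuel _)) bound)
  ...   | yes x∈walk with ∈-∃++ x∈walk
  ...     | []               , zs , refl = contradiction cur~x (λ x~x → adj-≢ G x~x refl)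
  ...     | _ ∷ []           , zs , refl = contradiction refl x≢prev
  ...     | _ ∷ _ ∷ ys       , zs , refl = close _ _ x ys zs distinct (cur~prev ∷ linked) cur~x

  cycle : ∀ {a b} → Adj G a b → HasCycle G
  cycle a~b = walk N _ _ [] ((adj-≢ G (adj-symm G a~b) ∷ []) ∷ [] ∷ []) (adj-symm G a~b ∷ [-])
    (m<m+n N (s≤s z≤n))

leaf-exists : ∀ {m} (T : Graph (suc (suc m))) → IsTree T → ∃ λ ℓ → ∃ λ p → IsLeaf T ℓ p
leaf-exists T (T-conn , no-cycle) with any? (λ ℓ → any? (λ p → leaf? ℓ p))
  where
  leaf? : ∀ ℓ p → Dec (IsLeaf T ℓ p)
  leaf? ℓ p = (adj T ℓ p ≟ᵇ true) ×-dec all? (λ x → (adj T ℓ x ≟ᵇ true) →-dec (x ≟ᶠ p))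
... | yes leaf = leaf
... | no no-leaf = contradiction (cycle-from (T-conn fzero (fsuc fzero))) no-cycle
  where
  branch : ∀ v p → Adj T v p → ∃ λ x → Adj T v x × x ≢ p
  branch v p v~p with ¬∀⟶∃¬ _ (λ x → Adj T v x → x ≡ p) (λ x → (adj T v x ≟ᵇ true) →-dec (x ≟ᶠ p))
                          (λ only-p → no-leaf (v , p , v~p , only-p))
  ... | x , not-only with adj T v x ≟ᵇ true
  ...   | yes v~x = x , v~x , (λ x≡p → not-only (λ _ → x≡p))
  ...   | no v≁x  = contradiction (λ v~x → contradiction v~x v≁x) not-only
  cycle-from : Reach T fzero (fsuc fzero) → HasCycle T
  cycle-from (step v~b _) = BranchingWalk.cycle T branch v~b

-- The degrees of a tree on m + 1 vertices sum to 2m (remove leaves one by one).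
tree-degree-sum : ∀ m (T : Graph (suc m)) → IsTree T → sum (deg T) ≡ m + m
tree-degree-sum zero    T _    =
  trans (+-identityʳ _) (trans (deg-remove T fzero fzero) (trans (+-identityʳ _) (cong ind (irrefl T fzero))))
tree-degree-sum (suc m) T T-tree with leaf-exists T T-tree
... | ℓ , p , leaf = begin
    sum (deg T)                         ≡⟨ degree-sum ⟩
    2 + sum (deg T′)                    ≡⟨ cong (2 +_) (tree-degree-sum m T′ (is-tree T-tree)) ⟩
    2 + (m + m)                         ≡⟨ cong suc (+-suc m m) ⟨
    suc m + suc m                       ∎
  where
  open ≡-Reasoning
  open LeafRemoval T leaf

tree-edges : ∀ m (T : Graph (suc m)) → IsTree T → edgeCount T ≡ m
tree-edges m T T-tree = double-injective (trans (sym (Handshake.handshake T)) (tree-degree-sum m T T-tree))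
  where
  double-injective : ∀ {a b} → a + a ≡ b + b → a ≡ b
  double-injective {zero}  {zero}  _ = refl
  double-injective {suc a} {suc b} e =
    cong suc (double-injective (suc-injective (trans (sym (+-suc a a)) (trans (suc-injective e) (+-suc b b)))))

star-with-centre : ∀ {N} (T : Graph (suc N)) → Connected T →
                   ∀ c → (∀ y → y ≢ c → deg T y ≤ 1) → IsStar T
star-with-centre T T-conn c small = c , spoke , through-centre
  where
  near : ∀ {s x} → Reach T s x → s ≡ c → x ≡ c ⊎ Adj T c x
  near here s≡c = inj₁ s≡c
  near (step {b = b} c~b b⇝x) refl = onward b⇝x
    where
    onward : ∀ {x} → Reach T b x → x ≡ c ⊎ Adj T c x
    onward here = inj₂ c~b
    onward (step b~d d⇝x) =
      near d⇝x (deg≤1-unique T (small b (≢-sym (adj-≢ T c~b))) b~d (adj-symm T c~b))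

  spoke : ∀ x → x ≢ c → Adj T c x
  spoke x x≢c with near (T-conn c x) refl
  ... | inj₁ x≡c = contradiction x≡c x≢c
  ... | inj₂ c~x = c~x

  through-centre : ∀ x y → Adj T x y → x ≡ c ⊎ y ≡ c
  through-centre x y x~y with x ≟ᶠ c | y ≟ᶠ c
  ... | yes x≡c | _       = inj₁ x≡c
  ... | no _    | yes y≡c = inj₂ y≡c
  ... | no x≢c  | no y≢c  =
    contradiction (deg≤1-unique T (small x x≢c) x~y (adj-symm T (spoke x x≢c))) y≢c

two-branch-vertices : ∀ {N} (T : Graph (suc N)) → Connected T → ¬ IsStar T →
                      ∃ λ x → ∃ λ y → x ≢ y × 2 ≤ deg T x × 2 ≤ deg T y
two-branch-vertices {N} T T-conn not-star
  with any? (λ x → any? (λ y → ¬? (x ≟ᶠ y) ×-dec (2 ≤? deg T x) ×-dec (2 ≤? deg T y)))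
... | yes found = found
... | no none   = contradiction (star-with-centre T T-conn centre small) not-star
  where
  -- with no two branch vertices, the (at most one) branch vertex is the centre
  centre : Fin (suc N)
  centre with any? (λ x → 2 ≤? deg T x)
  ... | yes (c , _) = c
  ... | no _        = fzero
  small : ∀ y → y ≢ centre → deg T y ≤ 1
  small y y≢c with 2 ≤? deg T y
  ... | no  y-small = ≤-pred (≰⇒> y-small)
  ... | yes y-big with any? (λ x → 2 ≤? deg T x)
  ...   | yes (c , c-big) = contradiction (y , c , y≢c , y-big , c-big) none
  ...   | no  no-big      = contradiction (y , y-big) no-big

-- Degree products

-- The degree product ∏_v g(d(v)); Π₁ is the case g x = x ^ 2 and Π₂ the case g = pw.
degree-product : ∀ {N} → (ℕ → ℕ) → Graph N → ℕ
degree-product {N} g H = product (List.map (g ∘ deg H) (List.allFin N))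

degree-product-prod : ∀ {N} (g : ℕ → ℕ) (H : Graph N) → degree-product g H ≡ prod (g ∘ deg H)
degree-product-prod g H = foldr-allFin _*_ 1 (g ∘ deg H)

-- The factor contributed by the vertices of G other than u; both constructions leave it unchanged.
outside : ∀ {n} (G : Graph (suc n)) → Fin (suc n) → (ℕ → ℕ) → ℕ
outside G u g = prod (λ a → g (deg G (punchIn u a)))

split-product : ∀ {n m} (G : Graph (suc n)) (u : Fin (suc n)) (H : Graph (suc n + m)) (g : ℕ → ℕ) →
  (∀ a → a ≢ u → deg H (a ↑ˡ m) ≡ deg G a) →
  prod (g ∘ deg H) ≡ (g (deg H (u ↑ˡ m)) * outside G u g) * prod (λ i → g (deg H (suc n ↑ʳ i)))
split-product {n} {m} G u H g unchanged = trans (prod-↑ {suc n} {m} (g ∘ deg H))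
  (cong (_* prod (λ i → g (deg H (suc n ↑ʳ i))))
    (trans (prod-remove {i = u} (λ a → g (deg H (a ↑ˡ m))))
      (cong (g (deg H (u ↑ˡ m)) *_)
        (prod-cong-≗ (λ a → cong g (unchanged (punchIn u a) (punchInᵢ≢i u a)))))))

≟-self : ∀ {n} (u : Fin n) → ⌊ u ≟ᶠ u ⌋ ≡ true
≟-self u = trans (isYes≗does (u ≟ᶠ u)) (dec-true (u ≟ᶠ u) refl)

≟-other : ∀ {n} {a u : Fin n} → a ≢ u → ⌊ a ≟ᶠ u ⌋ ≡ false
≟-other {a = a} {u} a≢u = trans (isYes≗does (a ≟ᶠ u)) (dec-false (a ≟ᶠ u) a≢u)

sum-select : ∀ {n} (u : Fin (suc n)) (c : Bool) → sum (λ b → ind (⌊ b ≟ᶠ u ⌋ ∧ c)) ≡ ind c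
sum-select u c = begin
    sum (λ b → ind (⌊ b ≟ᶠ u ⌋ ∧ c))
  ≡⟨ sum-remove {i = u} (λ b → ind (⌊ b ≟ᶠ u ⌋ ∧ c)) ⟩
    ind (⌊ u ≟ᶠ u ⌋ ∧ c) + sum (λ i → ind (⌊ punchIn u i ≟ᶠ u ⌋ ∧ c))
  ≡⟨ cong₂ _+_ (cong (λ b → ind (b ∧ c)) (≟-self u))
               (sum-zero _ (λ i → cong (λ b → ind (b ∧ c)) (≟-other (punchInᵢ≢i u i)))) ⟩
    ind c + 0
  ≡⟨ +-identityʳ (ind c) ⟩
    ind c
  ∎ where open ≡-Reasoning

deg-↑ : ∀ {n m} (H : Graph (n + m)) v →
        deg H v ≡ sum (λ b → ind (adj H v (b ↑ˡ m))) + sum (λ j → ind (adj H v (n ↑ʳ j)))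
deg-↑ {n} {m} H v = trans (deg-sum H v) (sum-↑ {n} {m} (λ x → ind (adj H v x)))

-- In GT = glueTree G u T w the vertex a ↑ˡ m is the vertex a of G, and suc n ↑ʳ i is
-- the vertex punchIn w i of T (w itself is identified with u).
module Glued {n m} (G : Graph (suc n)) (u : Fin (suc n)) (T : Graph (suc m)) (w : Fin (suc m)) where
  GT : Graph (suc n + m)
  GT = glueTree G u T w

  left-left : ∀ a b → adj GT (a ↑ˡ m) (b ↑ˡ m) ≡ adj G a b
  left-left a b rewrite splitAt-↑ˡ (suc n) a m | splitAt-↑ˡ (suc n) b m = refl

  left-right : ∀ a j → adj GT (a ↑ˡ m) (suc n ↑ʳ j) ≡ (⌊ a ≟ᶠ u ⌋ ∧ adj T w (punchIn w j))
  left-right a j rewrite splitAt-↑ˡ (suc n) a m | splitAt-↑ʳ (suc n) m j = refl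

  right-left : ∀ i b → adj GT (suc n ↑ʳ i) (b ↑ˡ m) ≡ (⌊ b ≟ᶠ u ⌋ ∧ adj T w (punchIn w i))
  right-left i b rewrite splitAt-↑ˡ (suc n) b m | splitAt-↑ʳ (suc n) m i = refl

  right-right : ∀ i j → adj GT (suc n ↑ʳ i) (suc n ↑ʳ j) ≡ adj T (punchIn w i) (punchIn w j)
  right-right i j rewrite splitAt-↑ʳ (suc n) m i | splitAt-↑ʳ (suc n) m j = refl

  deg-left : ∀ a → deg GT (a ↑ˡ m) ≡ deg G a + sum (λ j → ind (⌊ a ≟ᶠ u ⌋ ∧ adj T w (punchIn w j)))
  deg-left a = trans (deg-↑ {suc n} {m} GT (a ↑ˡ m))
    (cong₂ _+_ (trans (sum-cong-≗ (cong ind ∘ left-left a)) (sym (deg-sum G a)))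
               (sum-cong-≗ (cong ind ∘ left-right a)))

  deg-u : deg GT (u ↑ˡ m) ≡ deg G u + deg T w
  deg-u = trans (deg-left u) (cong (deg G u +_) (begin
      sum (λ j → ind (⌊ u ≟ᶠ u ⌋ ∧ adj T w (punchIn w j)))
    ≡⟨ sum-cong-≗ (λ j → cong (λ b → ind (b ∧ adj T w (punchIn w j))) (≟-self u)) ⟩
      sum (λ j → ind (adj T w (punchIn w j)))
    ≡⟨ cong (λ b → ind b + sum (λ j → ind (adj T w (punchIn w j)))) (irrefl T w) ⟨
      ind (adj T w w) + sum (λ j → ind (adj T w (punchIn w j)))
    ≡⟨ deg-remove T w w ⟨
      deg T w
    ∎))
    where open ≡-Reasoning

  deg-other : ∀ a → a ≢ u → deg GT (a ↑ˡ m) ≡ deg G a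
  deg-other a a≢u = trans (deg-left a) (trans (cong (deg G a +_)
    (sum-zero _ (λ j → cong (λ b → ind (b ∧ adj T w (punchIn w j))) (≟-other a≢u))))
    (+-identityʳ (deg G a)))

  deg-right : ∀ i → deg GT (suc n ↑ʳ i) ≡ deg T (punchIn w i)
  deg-right i = begin
      deg GT (suc n ↑ʳ i)
    ≡⟨ deg-↑ {suc n} {m} GT (suc n ↑ʳ i) ⟩
      sum (λ b → ind (adj GT (suc n ↑ʳ i) (b ↑ˡ m))) + sum (λ j → ind (adj GT (suc n ↑ʳ i) (suc n ↑ʳ j)))
    ≡⟨ cong₂ _+_ (trans (sum-cong-≗ (cong ind ∘ right-left i)) (sum-select u (adj T w (punchIn w i))))
                 (sum-cong-≗ (cong ind ∘ right-right i)) ⟩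
      ind (adj T w (punchIn w i)) + sum (λ j → ind (adj T (punchIn w i) (punchIn w j)))
    ≡⟨ cong (λ b → ind b + sum (λ j → ind (adj T (punchIn w i) (punchIn w j)))) (adj-comm T (punchIn w i) w) ⟨
      ind (adj T (punchIn w i) w) + sum (λ j → ind (adj T (punchIn w i) (punchIn w j)))
    ≡⟨ deg-remove T (punchIn w i) w ⟨
      deg T (punchIn w i)
    ∎ where open ≡-Reasoning

  merged : Fin (suc m) → ℕ
  merged = insertAt (λ i → deg T (punchIn w i)) w (deg G u + deg T w)

  glue-product : ∀ g → degree-product g GT ≡ prod (g ∘ merged) * outside G u g
  glue-product g = begin
      degree-product g GT
    ≡⟨ degree-product-prod g GT ⟩
      prod (g ∘ deg GT)
    ≡⟨ split-product G u GT g deg-other ⟩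
      (g (deg GT (u ↑ˡ m)) * outside G u g) * prod (λ i → g (deg GT (suc n ↑ʳ i)))
    ≡⟨ cong₂ (λ x y → (g x * outside G u g) * y) deg-u (prod-cong-≗ (cong g ∘ deg-right)) ⟩
      (g (deg G u + deg T w) * outside G u g) * prod (λ i → g (deg T (punchIn w i)))
    ≡⟨ xy∙z≈xz∙y (g (deg G u + deg T w)) (outside G u g) _ ⟩
      (g (deg G u + deg T w) * prod (λ i → g (deg T (punchIn w i)))) * outside G u g
    ≡⟨ cong (_* outside G u g) (prod-insertAt g _ w _) ⟨
      prod (g ∘ merged) * outside G u g
    ∎ where open ≡-Reasoning

  merged-≥ : ∀ v → deg T v ≤ merged v
  merged-≥ v with v ≟ᶠ w
  ... | yes refl = subst (deg T v ≤_) (sym (insertAt-lookup _ v _)) (m≤n+m (deg T v) (deg G u))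
  ... | no  v≢w  = subst (λ x → deg T x ≤ merged x) (punchIn-punchOut (v≢w ∘ sym))
      (subst (deg T (punchIn w (punchOut (v≢w ∘ sym))) ≤_) (sym (insertAt-punchIn _ w _ _)) ≤-refl)

  merged-sum : sum merged ≡ deg G u + sum (deg T)
  merged-sum = trans (sum-insertAt _ w _)
    (trans (+-assoc (deg G u) (deg T w) _) (cong (deg G u +_) (sym (sum-remove {i = w} (deg T)))))

module Pendants {n} (G : Graph (suc n)) (u : Fin (suc n)) (k : ℕ) where
  GS : Graph (suc n + k)
  GS = attachPendents G u k

  left-left : ∀ a b → adj GS (a ↑ˡ k) (b ↑ˡ k) ≡ adj G a b
  left-left a b rewrite splitAt-↑ˡ (suc n) a k | splitAt-↑ˡ (suc n) b k = refl

  left-right : ∀ a j → adj GS (a ↑ˡ k) (suc n ↑ʳ j) ≡ ⌊ a ≟ᶠ u ⌋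
  left-right a j rewrite splitAt-↑ˡ (suc n) a k | splitAt-↑ʳ (suc n) k j = refl

  right-left : ∀ i b → adj GS (suc n ↑ʳ i) (b ↑ˡ k) ≡ ⌊ b ≟ᶠ u ⌋
  right-left i b rewrite splitAt-↑ˡ (suc n) b k | splitAt-↑ʳ (suc n) k i = refl

  right-right : ∀ i j → adj GS (suc n ↑ʳ i) (suc n ↑ʳ j) ≡ false
  right-right i j rewrite splitAt-↑ʳ (suc n) k i | splitAt-↑ʳ (suc n) k j = refl

  deg-left : ∀ a → deg GS (a ↑ˡ k) ≡ deg G a + sum {k} (λ _ → ind ⌊ a ≟ᶠ u ⌋)
  deg-left a = trans (deg-↑ {suc n} {k} GS (a ↑ˡ k))
    (cong₂ _+_ (trans (sum-cong-≗ (cong ind ∘ left-left a)) (sym (deg-sum G a)))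
               (sum-cong-≗ (cong ind ∘ left-right a)))

  deg-u : deg GS (u ↑ˡ k) ≡ deg G u + k
  deg-u = trans (deg-left u)
    (cong (deg G u +_) (trans (sum-cong-≗ {k} (λ _ → cong ind (≟-self u))) (sum-ones k)))

  deg-other : ∀ a → a ≢ u → deg GS (a ↑ˡ k) ≡ deg G a
  deg-other a a≢u = trans (deg-left a)
    (trans (cong (deg G a +_) (sum-zero {k} _ (λ _ → cong ind (≟-other a≢u)))) (+-identityʳ (deg G a)))

  deg-right : ∀ i → deg GS (suc n ↑ʳ i) ≡ 1
  deg-right i = begin
      deg GS (suc n ↑ʳ i)
    ≡⟨ deg-↑ {suc n} {k} GS (suc n ↑ʳ i) ⟩
      sum (λ b → ind (adj GS (suc n ↑ʳ i) (b ↑ˡ k))) + sum (λ j → ind (adj GS (suc n ↑ʳ i) (suc n ↑ʳ j)))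
    ≡⟨ cong₂ _+_ (sum-cong-≗ (λ b → cong ind (trans (right-left i b) (sym (∧-identityʳ ⌊ b ≟ᶠ u ⌋)))))
                 (sum-zero _ (cong ind ∘ right-right i)) ⟩
      sum (λ b → ind (⌊ b ≟ᶠ u ⌋ ∧ true)) + 0
    ≡⟨ cong (_+ 0) (sum-select u true) ⟩
      1
    ∎ where open ≡-Reasoning

  pendant-product : ∀ g → g 1 ≡ 1 → degree-product g GS ≡ g (deg G u + k) * outside G u g
  pendant-product g g1≡1 = begin
      degree-product g GS
    ≡⟨ degree-product-prod g GS ⟩
      prod (g ∘ deg GS)
    ≡⟨ split-product G u GS g deg-other ⟩
      (g (deg GS (u ↑ˡ k)) * outside G u g) * prod (λ i → g (deg GS (suc n ↑ʳ i)))
    ≡⟨ cong₂ (λ x y → (g x * outside G u g) * y) deg-u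
             (trans (prod-cong-≗ (λ i → trans (cong g (deg-right i)) g1≡1)) (prod-ones k)) ⟩
      (g (deg G u + k) * outside G u g) * 1
    ≡⟨ *-identityʳ _ ⟩
      g (deg G u + k) * outside G u g
    ∎ where
    open ≡-Reasoning

-- The degrees `merged` on the T-side of GT are positive
-- (T is connected and has two distinct vertices x, y), so merged v = 1 + excess v.
module Reduction {n m} (G : Graph (suc n)) (u : Fin (suc n)) (T : Graph (suc m)) (w : Fin (suc m))
                 (T-tree : IsTree T) {x y : Fin (suc m)} (x≢y : x ≢ y) where
  open Glued G u T w using (GT) public
  open Pendants G u (edgeCount T) using (GS) public
  open Glued G u T w using (merged; merged-≥; merged-sum; glue-product)
  open Pendants G u (edgeCount T) using (pendant-product)

  excess : Fin (suc m) → ℕ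
  excess = pred ∘ merged

  merged≗ : merged ≗ suc ∘ excess
  merged≗ v = sym (suc-pred (merged v) {{>-nonZero (≤-trans (T-positive v) (merged-≥ v))}})
    where
    T-positive : ∀ v → 1 ≤ deg T v
    T-positive = connected-positive T (proj₁ T-tree) x≢y

  branch-excess : ∀ {v} → 2 ≤ deg T v → 1 ≤ excess v
  branch-excess {v} 2≤d = ≤-pred (subst (2 ≤_) (merged≗ v) (≤-trans 2≤d (merged-≥ v)))

  -- the vertex u of GS has degree deg G u + |E(T)| = 1 + Σ excess, as Σ deg T = 2|E(T)| = 2m
  merged-degree : deg G u + edgeCount T ≡ suc (sum excess)
  merged-degree = begin
      deg G u + edgeCount T  ≡⟨ cong (deg G u +_) (tree-edges m T T-tree) ⟩
      deg G u + m            ≡⟨ +-cancelʳ-≡ m _ _ twice ⟩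
      suc (sum excess)       ∎
    where
    open ≡-Reasoning
    twice : deg G u + m + m ≡ suc (sum excess) + m
    twice = begin
      deg G u + m + m         ≡⟨ +-assoc (deg G u) m m ⟩
      deg G u + (m + m)       ≡⟨ cong (deg G u +_) (tree-degree-sum m T T-tree) ⟨
      deg G u + sum (deg T)   ≡⟨ merged-sum ⟨
      sum merged              ≡⟨ sum-cong-≗ merged≗ ⟩
      sum (suc ∘ excess)      ≡⟨ sum-suc excess ⟩
      sum excess + suc m      ≡⟨ +-suc (sum excess) m ⟩
      suc (sum excess) + m    ∎

  GS-product : ∀ g → g 1 ≡ 1 → degree-product g GS ≡ g (suc (sum excess)) * outside G u g
  GS-product g g1≡1 = trans (pendant-product g g1≡1) (cong (λ d → g d * outside G u g) merged-degree)

  GT-product : ∀ g → degree-product g GT ≡ prod (g ∘ suc ∘ excess) * outside G u g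
  GT-product g = trans (glue-product g) (cong (_* outside G u g) (prod-cong-≗ (cong g ∘ merged≗)))

lemma2p5 : ∀ {n m} (G : Graph n) (u : Fin n) (T : Graph (suc m)) (w : Fin (suc m)) →
    Connected G → IsTree T → ¬ IsStar T →
    (Π₁ (attachPendents G u (edgeCount T)) < Π₁ (glueTree G u T w))
    × (Π₂ (glueTree G u T w) < Π₂ (attachPendents G u (edgeCount T)))
lemma2p5 {zero} G () T w
lemma2p5 {suc n} {m} G u T w G-conn T-tree not-star
  with two-branch-vertices T (proj₁ T-tree) not-star
... | x , y , x≢y , 2≤dx , 2≤dy = Π₁-GS<GT , Π₂-GT<GS
  where
  open Reduction G u T w T-tree x≢y

  merge-Π₁ : suc (sum excess) < prod (suc ∘ excess)
  merge-Π₁ = merge-all-<-prod excess x≢y (branch-excess 2≤dx) (branch-excess 2≤dy)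

  merge-Π₂ : prod (pw ∘ suc ∘ excess) < pw (suc (sum excess))
  merge-Π₂ = merge-all-pw-< excess x≢y (branch-excess 2≤dx) (branch-excess 2≤dy)

  -- the common factors are positive (for Π₁ because G is connected)
  O₁ O₂ : ℕ
  O₁ = outside G u (_^ 2)
  O₂ = outside G u pw
  instance
    O₁≢0 : NonZero O₁
    O₁≢0 = >-nonZero (prod-positive _ (λ a → ^-monoˡ-≤ 2 (connected-deg-≥1 G G-conn (punchInᵢ≢i u a))))
    O₂≢0 : NonZero O₂
    O₂≢0 = >-nonZero (prod-positive _ (λ a → pw-positive (deg G (punchIn u a))))

  Π₁-GS<GT : Π₁ GS < Π₁ GT
  Π₁-GS<GT = begin-strict
    Π₁ GS                                 ≡⟨ GS-product (_^ 2) refl ⟩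
    suc (sum excess) ^ 2 * O₁             <⟨ *-monoˡ-< O₁ (^-monoˡ-< 2 merge-Π₁) ⟩
    prod (suc ∘ excess) ^ 2 * O₁          ≡⟨ cong (_* O₁) (prod-square (suc ∘ excess)) ⟨
    prod (λ v → suc (excess v) ^ 2) * O₁  ≡⟨ GT-product (_^ 2) ⟨
    Π₁ GT                                 ∎
    where open ≤-Reasoning

  Π₂-GT<GS : Π₂ GT < Π₂ GS
  Π₂-GT<GS = begin-strict
    Π₂ GT                           ≡⟨ GT-product pw ⟩
    prod (pw ∘ suc ∘ excess) * O₂   <⟨ *-monoˡ-< O₂ merge-Π₂ ⟩
    pw (suc (sum excess)) * O₂      ≡⟨ GS-product pw refl ⟨
    Π₂ GS                           ∎
    where open ≤-Reasoning
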